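{- Let $n$ be an entry in column $1$ of the Trithoff array, lying in row $r$, and write its canonical Tribonacci representation (padded with leading zeros if necessary) as $abc1$, where $b,c\in\{0,1\}$ are digits and $a$ is a binary word. Then the wall, seed and pre-seed of row $r$ are \[T_{r,0}=[abc]_T+1,\qquad T_{r,-1}=[ab]_T+c,\qquad T_{r,-2}=[a]_T+b.\]
   Context: Tribonacci numbers: $T_0=0,T_1=0,T_2=1$, $T_n=T_{n-1}+T_{n-2}+T_{n-3}$ ($n\ge3$). For a word $w=d_k\cdots d_0$ of digits, $[w]_T=\sum_i d_iT_{i+3}$ (empty word: $0$). A canonical Tribonacci representation is such a word with digits in $\{0,1\}$ and no three consecutive $1$s; every $N\ge0$ has a unique one, and the successor is $\operatorname{out}([w]_T)=[w0]_T$ for canonical $w$. Trithoff array: $T_{r,1}$ is the $r$-th smallest positive integer whose canonical representation ends in $1$, and $T_{r,c+1}=\operatorname{out}(T_{r,c})$ for $c\ge1$; each row satisfies $T_{r,c+3}=T_{r,c+2}+T_{r,c+1}+T_{r,c}$. The array is extended to columns $c\le0$ by this same rule: $T_{r,0}=T_{r,3}-T_{r,2}-T_{r,1}$ (the wall), $T_{r,-1}=T_{r,2}-T_{r,1}-T_{r,0}$ (the seed), $T_{r,-2}=T_{r,1}-T_{r,0}-T_{r,-1}$ (the pre-seed). -}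

module Defs where

open import Data.Nat using (ℕ; zero; suc; _+_; _*_; _≤_; _<_)
open import Data.Integer as ℤ using (ℤ; +_)
open import Data.List using (List; []; _∷_; _++_; reverse; length)
open import Data.List.Relation.Unary.All using (All)
open import Data.List.Relation.Unary.Unique.Propositional using (Unique)
open import Data.List.Membership.Propositional using (_∈_)
open import Data.Product using (Σ; _×_; ∃)
open import Relation.Binary.PropositionalEquality using (_≡_)
open import Relation.Nullary using (¬_)
open import Function.Bundles using (_⇔_)

trib : ℕ → ℕ
trib 0 = 0
trib 1 = 0
trib 2 = 1
trib (suc (suc (suc n))) = trib (suc (suc n)) + trib (suc n) + trib n

-- A word is a list of digits written most-significant first: d_k ∷ ... ∷ d_0 ∷ [].
Word : Set
Word = List ℕ

valFrom : ℕ → List ℕ → ℕ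
valFrom i [] = 0
valFrom i (d ∷ ds) = d * trib (i + 3) + valFrom (suc i) ds

⟦_⟧T : Word → ℕ
⟦ w ⟧T = valFrom 0 (reverse w)

Canonical : Word → Set
Canonical w = All (λ d → d ≤ 1) w
            × ¬ (Σ Word λ xs → Σ Word λ ys → w ≡ xs ++ (1 ∷ 1 ∷ 1 ∷ ys))

EndsIn1 : ℕ → Set
EndsIn1 N = Σ Word λ w → Canonical w × ⟦ w ++ (1 ∷ []) ⟧T ≡ N × Canonical (w ++ (1 ∷ []))

IsOut : ℕ → ℕ → Set
IsOut N M = Σ Word λ w → Canonical w × ⟦ w ⟧T ≡ N × ⟦ w ++ (0 ∷ []) ⟧T ≡ M

-- T_{r,1} = n : n is the r-th smallest positive integer whose canonical
-- representation ends in 1 (r ≥ 1); i.e. the positive m < n with that property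
-- are exactly r - 1 many.
IsColumn1Entry : ℕ → ℕ → Set
IsColumn1Entry r n =
  1 ≤ n × EndsIn1 n ×
  Σ (List ℕ) λ xs → Unique xs
    × (∀ m → (m ∈ xs) ⇔ (1 ≤ m × m < n × EndsIn1 m))
    × suc (length xs) ≡ r

-- Extension of a row to columns ≤ 0 from its entries t1 = T_{r,1}, t2 = T_{r,2}, t3 = T_{r,3}
wall : ℤ → ℤ → ℤ → ℤ
wall t1 t2 t3 = t3 ℤ.- t2 ℤ.- t1

seed : ℤ → ℤ → ℤ → ℤ
seed t1 t2 t3 = t2 ℤ.- t1 ℤ.- wall t1 t2 t3

preSeed : ℤ → ℤ → ℤ → ℤ
preSeed t1 t2 t3 = t1 ℤ.- wall t1 t2 t3 ℤ.- seed t1 t2 t3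

-- Let v = abc1 be the canonical representation of n, and let shiftVal k v be its value
-- with the digit in position i weighted by T_(i+k) instead of T_(i+3). Appending a zero
-- to a canonical word keeps it canonical and raises k by one, so by uniqueness of
-- canonical representations the row of n reads shiftVal 3 v, shiftVal 4 v, shiftVal 5 v.
-- In k these values obey the Tribonacci recurrence, so running it backwards gives wall,
-- seed and pre-seed as shiftVal 2 v, shiftVal 1 v, shiftVal 0 v; since T₀ = T₁ = 0 and
-- T₂ = 1, these are the stated truncations of v.
module Submission where

open import Defs
open import Data.Nat using (ℕ; _≤_)
open import Data.Integer as ℤ using (+_)
open import Data.List using ([]; _∷_; _++_)
open import Data.Product using (_×_)
open import Relation.Binary.PropositionalEquality using (_≡_)

open import Data.Nat using (suc; _+_; _*_; _<_; _≤′_; ≤′-refl; ≤′-step; z≤n; s≤s)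
open import Data.Nat.Properties
open import Data.Nat.Tactic.RingSolver using (solve-∀)
import Data.Integer.Tactic.RingSolver as ℤ-Solver
open import Data.List using (length; reverse)
open import Data.List.Properties using (∷-injective; length-++; unfold-reverse; reverse-involutive)
open import Data.List.Relation.Unary.All using ([]; _∷_)
open import Data.List.Relation.Unary.All.Properties using (++⁺)
open import Data.Product using (Σ; _,_)
open import Data.Empty using (⊥-elim)
open import Relation.Binary.Definitions using (tri<; tri≈; tri>)
open import Relation.Binary.PropositionalEquality using (refl; sym; trans; cong; cong₂; module ≡-Reasoning)
open import Relation.Nullary using (¬_)

trib-≤-suc : ∀ n → trib n ≤ trib (suc n)
trib-≤-suc 0 = z≤n
trib-≤-suc 1 = z≤n
trib-≤-suc 2 = ≤-refl
trib-≤-suc (suc (suc (suc n))) = ≤-trans (m≤m+n _ _) (m≤m+n _ _)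

trib-mono-≤ : ∀ {m n} → m ≤ n → trib m ≤ trib n
trib-mono-≤ m≤n = go (≤⇒≤′ m≤n)
  where
  go : ∀ {m n} → m ≤′ n → trib m ≤ trib n
  go ≤′-refl = ≤-refl
  go (≤′-step {n} p) = ≤-trans (go p) (trib-≤-suc n)

canonical-tail : ∀ {d ds} → Canonical (d ∷ ds) → Canonical ds
canonical-tail (_ ∷ digits , no111) =
  digits , λ (xs , ys , eq) → no111 (_ ∷ xs , ys , cong (_ ∷_) eq)

¬canonical-111 : ∀ {ys} → ¬ Canonical (1 ∷ 1 ∷ 1 ∷ ys)
¬canonical-111 (_ , no111) = no111 ([] , _ , refl)

¬canonical-digit≥2 : ∀ {d ds} → ¬ Canonical (suc (suc d) ∷ ds)
¬canonical-digit≥2 (s≤s () ∷ _ , _)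

111-in-∷ʳ-0 : ∀ w xs ys → w ++ 0 ∷ [] ≡ xs ++ 1 ∷ 1 ∷ 1 ∷ ys →
              Σ Word λ ys′ → w ≡ xs ++ 1 ∷ 1 ∷ 1 ∷ ys′
111-in-∷ʳ-0 (_ ∷ _ ∷ _ ∷ w) [] ys refl = w , refl
111-in-∷ʳ-0 (_ ∷ w) (_ ∷ xs) ys eq with ∷-injective eq
... | refl , eq′ with 111-in-∷ʳ-0 w xs ys eq′
...   | ys′ , refl = ys′ , refl
111-in-∷ʳ-0 [] [] _ ()
111-in-∷ʳ-0 (_ ∷ []) [] _ ()
111-in-∷ʳ-0 (_ ∷ _ ∷ []) [] _ ()
111-in-∷ʳ-0 [] (_ ∷ []) _ ()
111-in-∷ʳ-0 [] (_ ∷ _ ∷ _) _ ()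

canonical-∷ʳ-0 : ∀ {w} → Canonical w → Canonical (w ++ 0 ∷ [])
canonical-∷ʳ-0 {w} (digits , no111) =
  ++⁺ digits (z≤n ∷ []) ,
  λ (xs , ys , eq) → let ys′ , eq′ = 111-in-∷ʳ-0 w xs ys eq in no111 (xs , ys′ , eq′)

shiftVal : ℕ → Word → ℕ
shiftVal k [] = 0
shiftVal k (d ∷ ds) = d * trib (k + length ds) + shiftVal k ds

shiftVal-1∷ : ∀ k ds → shiftVal k (1 ∷ ds) ≡ trib (k + length ds) + shiftVal k ds
shiftVal-1∷ k ds = cong (_+ shiftVal k ds) (*-identityˡ _)

shiftVal-++ : ∀ k u ds → shiftVal k (u ++ ds) ≡ shiftVal (length ds + k) u + shiftVal k ds
shiftVal-++ k [] ds = refl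
shiftVal-++ k (d ∷ u) ds = begin
  d * trib (k + length (u ++ ds)) + shiftVal k (u ++ ds)
    ≡⟨ cong₂ _+_ (cong (λ i → d * trib i) index) (shiftVal-++ k u ds) ⟩
  d * trib (length ds + k + length u) + (shiftVal (length ds + k) u + shiftVal k ds)
    ≡⟨ +-assoc (d * trib (length ds + k + length u)) _ _ ⟨
  d * trib (length ds + k + length u) + shiftVal (length ds + k) u + shiftVal k ds ∎
  where
  open ≡-Reasoning
  index : k + length (u ++ ds) ≡ length ds + k + length u
  index = trans (cong (_+_ k) (length-++ u)) (reorder k (length u) (length ds))
    where
    reorder : ∀ k m n → k + (m + n) ≡ n + k + m
    reorder = solve-∀

shiftVal-∷ʳ : ∀ k u d → shiftVal k (u ++ d ∷ []) ≡ shiftVal (suc k) u + d * trib k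
shiftVal-∷ʳ k u d =
  trans (shiftVal-++ k u (d ∷ []))
        (cong (_+_ (shiftVal (suc k) u)) (trans (+-identityʳ _) (cong (λ i → d * trib i) (+-identityʳ k))))

shiftVal-∷ʳ-0 : ∀ k u → shiftVal k (u ++ 0 ∷ []) ≡ shiftVal (suc k) u
shiftVal-∷ʳ-0 k u = trans (shiftVal-∷ʳ k u 0) (+-identityʳ _)

valFrom-reverse : ∀ i xs → valFrom i xs ≡ shiftVal (i + 3) (reverse xs)
valFrom-reverse i [] = refl
valFrom-reverse i (x ∷ xs) = begin
  x * trib (i + 3) + valFrom (suc i) xs          ≡⟨ cong (_+_ (x * trib (i + 3))) (valFrom-reverse (suc i) xs) ⟩
  x * trib (i + 3) + shiftVal (suc i + 3) (reverse xs) ≡⟨ +-comm (x * trib (i + 3)) _ ⟩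
  shiftVal (suc i + 3) (reverse xs) + x * trib (i + 3) ≡⟨ shiftVal-∷ʳ (i + 3) (reverse xs) x ⟨
  shiftVal (i + 3) (reverse xs ++ x ∷ [])         ≡⟨ cong (shiftVal (i + 3)) (unfold-reverse x xs) ⟨
  shiftVal (i + 3) (reverse (x ∷ xs))             ∎
  where open ≡-Reasoning

⟦⟧T≡shiftVal₃ : ∀ w → ⟦ w ⟧T ≡ shiftVal 3 w
⟦⟧T≡shiftVal₃ w = trans (valFrom-reverse 0 (reverse w)) (cong (shiftVal 3) (reverse-involutive w))

shiftVal-rec : ∀ u k → shiftVal (3 + k) u ≡ shiftVal (2 + k) u + shiftVal (1 + k) u + shiftVal k u
shiftVal-rec [] k = refl
shiftVal-rec (d ∷ u) k rewrite shiftVal-rec u k =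
  distrib d (trib (2 + k + length u)) (trib (1 + k + length u)) (trib (k + length u))
            (shiftVal (2 + k) u) (shiftVal (1 + k) u) (shiftVal k u)
  where
  distrib : ∀ d A B C x y z → d * (A + B + C) + (x + y + z) ≡ (d * A + x) + (d * B + y) + (d * C + z)
  distrib = solve-∀

shiftVal₃-bound : ∀ ws → Canonical ws → shiftVal 3 ws < trib (3 + length ws)
shiftVal₃-bound [] _ = s≤s z≤n
shiftVal₃-bound (0 ∷ ds) can =
  ≤-trans (shiftVal₃-bound ds (canonical-tail can)) (trib-≤-suc (3 + length ds))
shiftVal₃-bound (1 ∷ []) _ = s≤s (s≤s z≤n)
shiftVal₃-bound (1 ∷ 1 ∷ []) _ = s≤s (s≤s (s≤s (s≤s z≤n)))
shiftVal₃-bound (1 ∷ 0 ∷ ds) can = begin-strict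
  shiftVal 3 (1 ∷ 0 ∷ ds)         ≡⟨ shiftVal-1∷ 3 (0 ∷ ds) ⟩
  trib (4 + l) + shiftVal 3 ds    <⟨ +-monoʳ-< (trib (4 + l)) (shiftVal₃-bound ds (canonical-tail (canonical-tail can))) ⟩
  trib (4 + l) + trib (3 + l)     ≤⟨ m≤m+n _ _ ⟩
  trib (5 + l)                    ∎
  where
  open ≤-Reasoning
  l = length ds
shiftVal₃-bound (1 ∷ 1 ∷ 0 ∷ ds) can = begin-strict
  shiftVal 3 (1 ∷ 1 ∷ 0 ∷ ds)                  ≡⟨ shiftVal-1∷ 3 (1 ∷ 0 ∷ ds) ⟩
  trib (5 + l) + shiftVal 3 (1 ∷ 0 ∷ ds)       ≡⟨ cong (_+_ (trib (5 + l))) (shiftVal-1∷ 3 (0 ∷ ds)) ⟩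
  trib (5 + l) + (trib (4 + l) + shiftVal 3 ds) ≡⟨ +-assoc (trib (5 + l)) _ _ ⟨
  trib (5 + l) + trib (4 + l) + shiftVal 3 ds  <⟨ +-monoʳ-< _ (shiftVal₃-bound ds (canonical-tail (canonical-tail (canonical-tail can)))) ⟩
  trib (6 + l)                                 ∎
  where
  open ≤-Reasoning
  l = length ds
shiftVal₃-bound (1 ∷ 1 ∷ 1 ∷ _) can = ⊥-elim (¬canonical-111 can)
shiftVal₃-bound (1 ∷ 1 ∷ suc (suc _) ∷ _) can = ⊥-elim (¬canonical-digit≥2 (canonical-tail (canonical-tail can)))
shiftVal₃-bound (1 ∷ suc (suc _) ∷ _) can = ⊥-elim (¬canonical-digit≥2 (canonical-tail can))
shiftVal₃-bound (suc (suc _) ∷ _) can = ⊥-elim (¬canonical-digit≥2 can)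

trib-≤-shiftVal₃-1∷ : ∀ xs → trib (3 + length xs) ≤ shiftVal 3 (1 ∷ xs)
trib-≤-shiftVal₃-1∷ xs = ≤-trans (m≤m+n _ _) (≤-reflexive (sym (shiftVal-1∷ 3 xs)))

shiftVal₃-1∷-dominates : ∀ xs ys → Canonical ys → length ys ≤ length xs → shiftVal 3 ys < shiftVal 3 (1 ∷ xs)
shiftVal₃-1∷-dominates xs ys can ys≤xs =
  <-≤-trans (shiftVal₃-bound ys can)
            (≤-trans (trib-mono-≤ (+-monoʳ-≤ 3 ys≤xs)) (trib-≤-shiftVal₃-1∷ xs))

shiftVal₃-1∷-positive : ∀ xs → 0 < shiftVal 3 (1 ∷ xs)
shiftVal₃-1∷-positive xs = ≤-trans (trib-mono-≤ (m≤m+n 3 (length xs))) (trib-≤-shiftVal₃-1∷ xs)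

-- Equal values of canonical words mean equal words up to leading zeros, so every shift agrees.
canonical-shiftVal-unique : ∀ k xs ys → Canonical xs → Canonical ys →
                            shiftVal 3 xs ≡ shiftVal 3 ys → shiftVal k xs ≡ shiftVal k ys
canonical-shiftVal-unique k [] [] _ _ _ = refl
canonical-shiftVal-unique k (0 ∷ xs) ys cx cy eq = canonical-shiftVal-unique k xs ys (canonical-tail cx) cy eq
canonical-shiftVal-unique k xs (0 ∷ ys) cx cy eq = canonical-shiftVal-unique k xs ys cx (canonical-tail cy) eq
canonical-shiftVal-unique k [] (1 ∷ ys) _ _ eq = ⊥-elim (<-irrefl eq (shiftVal₃-1∷-positive ys))
canonical-shiftVal-unique k (1 ∷ xs) [] _ _ eq = ⊥-elim (<-irrefl (sym eq) (shiftVal₃-1∷-positive xs))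
canonical-shiftVal-unique k (1 ∷ xs) (1 ∷ ys) cx cy eq with <-cmp (length xs) (length ys)
... | tri< xs<ys _ _ = ⊥-elim (<-irrefl eq (shiftVal₃-1∷-dominates ys (1 ∷ xs) cx xs<ys))
... | tri> _ _ ys<xs = ⊥-elim (<-irrefl (sym eq) (shiftVal₃-1∷-dominates xs (1 ∷ ys) cy ys<xs))
... | tri≈ _ xs≈ys _ = begin
  shiftVal k (1 ∷ xs)                      ≡⟨ shiftVal-1∷ k xs ⟩
  trib (k + length xs) + shiftVal k xs     ≡⟨ cong₂ _+_ (cong (λ l → trib (k + l)) xs≈ys) tails-equal ⟩
  trib (k + length ys) + shiftVal k ys     ≡⟨ shiftVal-1∷ k ys ⟨
  shiftVal k (1 ∷ ys)                      ∎
  where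
  open ≡-Reasoning
  tails-equal : shiftVal k xs ≡ shiftVal k ys
  tails-equal = canonical-shiftVal-unique k xs ys (canonical-tail cx) (canonical-tail cy)
    (+-cancelˡ-≡ (trib (3 + length ys)) _ _ (begin
      trib (3 + length ys) + shiftVal 3 xs  ≡⟨ cong (λ l → trib (3 + l) + shiftVal 3 xs) xs≈ys ⟨
      trib (3 + length xs) + shiftVal 3 xs  ≡⟨ shiftVal-1∷ 3 xs ⟨
      shiftVal 3 (1 ∷ xs)                   ≡⟨ eq ⟩
      shiftVal 3 (1 ∷ ys)                   ≡⟨ shiftVal-1∷ 3 ys ⟩
      trib (3 + length ys) + shiftVal 3 ys  ∎))
canonical-shiftVal-unique k (suc (suc _) ∷ _) _ cx _ _ = ⊥-elim (¬canonical-digit≥2 cx)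
canonical-shiftVal-unique k _ (suc (suc _) ∷ _) _ cy _ = ⊥-elim (¬canonical-digit≥2 cy)

isOut-shiftVal : ∀ {v n m} → Canonical v → ⟦ v ⟧T ≡ n → IsOut n m → m ≡ shiftVal 4 v
isOut-shiftVal {v} cv refl (w , cw , w≈v , refl) = begin
  ⟦ w ++ 0 ∷ [] ⟧T           ≡⟨ ⟦⟧T≡shiftVal₃ (w ++ 0 ∷ []) ⟩
  shiftVal 3 (w ++ 0 ∷ [])    ≡⟨ shiftVal-∷ʳ-0 3 w ⟩
  shiftVal 4 w                ≡⟨ canonical-shiftVal-unique 4 w v cw cv
                                   (trans (sym (⟦⟧T≡shiftVal₃ w)) (trans w≈v (⟦⟧T≡shiftVal₃ v))) ⟩
  shiftVal 4 v                ∎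
  where open ≡-Reasoning

row-shiftVal : ∀ {v n t₂ t₃} → Canonical v → ⟦ v ⟧T ≡ n → IsOut n t₂ → IsOut t₂ t₃ →
               n ≡ shiftVal 3 v × t₂ ≡ shiftVal 4 v × t₃ ≡ shiftVal 5 v
row-shiftVal {v} cv refl out₁ out₂ with isOut-shiftVal cv refl out₁
... | refl = ⟦⟧T≡shiftVal₃ v , refl ,
             trans (isOut-shiftVal (canonical-∷ʳ-0 cv) v0≈t₂ out₂) (shiftVal-∷ʳ-0 4 v)
  where
  v0≈t₂ : ⟦ v ++ 0 ∷ [] ⟧T ≡ shiftVal 4 v
  v0≈t₂ = trans (⟦⟧T≡shiftVal₃ (v ++ 0 ∷ [])) (shiftVal-∷ʳ-0 3 v)

+[x+y+z]-x-y≡z : ∀ x y z → + (x + y + z) ℤ.- + x ℤ.- + y ≡ + z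
+[x+y+z]-x-y≡z x y z = cancel (+ x) (+ y) (+ z)
  where
  cancel : ∀ x y z → x ℤ.+ y ℤ.+ z ℤ.- x ℤ.- y ≡ z
  cancel = ℤ-Solver.solve-∀

backward-extension : (f : ℕ → ℕ) → (∀ k → f (3 + k) ≡ f (2 + k) + f (1 + k) + f k) →
  wall (+ f 3) (+ f 4) (+ f 5) ≡ + f 2
  × seed (+ f 3) (+ f 4) (+ f 5) ≡ + f 1
  × preSeed (+ f 3) (+ f 4) (+ f 5) ≡ + f 0
backward-extension f rec = wall≡ , seed≡ , preSeed≡
  where
  step : ∀ k → + f (3 + k) ℤ.- + f (2 + k) ℤ.- + f (1 + k) ≡ + f k
  step k = trans (cong (λ x → + x ℤ.- + f (2 + k) ℤ.- + f (1 + k)) (rec k))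
                 (+[x+y+z]-x-y≡z (f (2 + k)) (f (1 + k)) (f k))
  wall≡ = step 2
  seed≡ = trans (cong (λ w → + f 4 ℤ.- + f 3 ℤ.- w) wall≡) (step 1)
  preSeed≡ = trans (cong₂ (λ w s → + f 3 ℤ.- w ℤ.- s) wall≡ seed≡) (step 0)

⟦⟧T-++ : ∀ a ds → ⟦ a ++ ds ⟧T ≡ shiftVal (length ds + 3) a + shiftVal 3 ds
⟦⟧T-++ a ds = trans (⟦⟧T≡shiftVal₃ (a ++ ds)) (shiftVal-++ 3 a ds)

-- T₄ = 2, T₃ = T₂ = 1 and T₁ = T₀ = 0 are the digit weights below.
shiftVal-abc1 : ∀ a b c →
  shiftVal 2 (a ++ b ∷ c ∷ 1 ∷ []) ≡ ⟦ a ++ b ∷ c ∷ [] ⟧T + 1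
  × shiftVal 1 (a ++ b ∷ c ∷ 1 ∷ []) ≡ ⟦ a ++ b ∷ [] ⟧T + c
  × shiftVal 0 (a ++ b ∷ c ∷ 1 ∷ []) ≡ ⟦ a ⟧T + b
shiftVal-abc1 a b c =
  trans (shiftVal-++ 2 a abc1) (trans (weights₂ (shiftVal 5 a) b c) (cong (_+ 1) (sym (⟦⟧T-++ a (b ∷ c ∷ []))))) ,
  trans (shiftVal-++ 1 a abc1) (trans (weights₁ (shiftVal 4 a) b c) (cong (_+ c) (sym (⟦⟧T-++ a (b ∷ [])))))  ,
  trans (shiftVal-++ 0 a abc1) (trans (weights₀ (shiftVal 3 a) b c) (cong (_+ b) (sym (⟦⟧T≡shiftVal₃ a))))
  where
  abc1 = b ∷ c ∷ 1 ∷ []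
  weights₂ : ∀ x b c → x + (b * 2 + (c * 1 + (1 * 1 + 0))) ≡ x + (b * 2 + (c * 1 + 0)) + 1
  weights₂ = solve-∀
  weights₁ : ∀ x b c → x + (b * 1 + (c * 1 + (1 * 0 + 0))) ≡ x + (b * 1 + 0) + c
  weights₁ = solve-∀
  weights₀ : ∀ x b c → x + (b * 1 + (c * 0 + (1 * 0 + 0))) ≡ x + b
  weights₀ = solve-∀

mainTheorem11 : (r n t2 t3 : ℕ) (a : Word) (b c : ℕ) →
    IsColumn1Entry r n →
    IsOut n t2 → IsOut t2 t3 →
    b ≤ 1 → c ≤ 1 →
    Canonical (a ++ (b ∷ c ∷ 1 ∷ [])) → ⟦ a ++ (b ∷ c ∷ 1 ∷ []) ⟧T ≡ n →
    (wall (+ n) (+ t2) (+ t3) ≡ + ⟦ a ++ (b ∷ c ∷ []) ⟧T ℤ.+ + 1)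
    × (seed (+ n) (+ t2) (+ t3) ≡ + ⟦ a ++ (b ∷ []) ⟧T ℤ.+ + c)
    × (preSeed (+ n) (+ t2) (+ t3) ≡ + ⟦ a ⟧T ℤ.+ + b)
mainTheorem11 r n t2 t3 a b c _ out₁ out₂ _ _ cv ev
  with refl , refl , refl ← row-shiftVal cv ev out₁ out₂
  with wall≡ , seed≡ , preSeed≡ ←
         backward-extension (λ k → shiftVal k (a ++ b ∷ c ∷ 1 ∷ [])) (shiftVal-rec (a ++ b ∷ c ∷ 1 ∷ []))
  with wall-digits , seed-digits , preSeed-digits ← shiftVal-abc1 a b c
  = trans wall≡ (cong +_ wall-digits) ,
    trans seed≡ (cong +_ seed-digits) ,
    trans preSeed≡ (cong +_ preSeed-digits)
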